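{- For every positive integer $n$ and integer $r\ge 0$, \[ \frac{1}{\sqrt{n}}\,\mathbb{F}_{n-1}^{(r+1)}\le\sqrt{\sum_{k=0}^{n-1}\left(\mathbb{F}_{k}^{(r)}\right)^{2}}\le \mathbb{F}_{n-1}^{(r+1)}. \]
   Context: $F_n$ denotes the Fibonacci numbers: $F_0=0$, $F_1=1$, $F_{n+2}=F_{n+1}+F_n$. The hyperharmonic Fibonacci numbers are defined by $\mathbb{F}_{n}^{(0)}=\frac{1}{F_{n}}$ for $n\ge1$, $\mathbb{F}_0^{(k)}=0$ for all $k\ge 0$, and $\mathbb{F}_{n}^{(r)}=\sum_{k=1}^{n}\mathbb{F}_{k}^{(r-1)}$ for $n,r\ge 1$. -}

module Defs where

open import Data.Nat as ℕ using (ℕ; zero; suc; z<s; s<s; _<_)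
open import Data.Nat.Properties using (<-≤-trans; m≤m+n)
open import Data.Integer using (+_)
open import Data.Rational using (ℚ; 0ℚ; _+_; _/_)

fib : ℕ → ℕ
fib zero = 0
fib (suc zero) = 1
fib (suc (suc n)) = fib (suc n) ℕ.+ fib n

fib-pos : ∀ m → 0 < fib (suc m)
fib-pos zero = z<s
fib-pos (suc m) = <-≤-trans (fib-pos m) (m≤m+n (fib (suc m)) (fib m))

-- 1 / F_n for n ≥ 1, as a rational (written n = suc m)
recipFib : ℕ → ℚ
recipFib m = _/_ (+ 1) (fib (suc m)) {{ℕ.>-nonZero (fib-pos m)}}

-- Hyperharmonic Fibonacci numbers: hyperFib r n = 𝔽_n^{(r)}
--   𝔽_0^{(k)} = 0, 𝔽_n^{(0)} = 1/F_n (n ≥ 1),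
--   𝔽_n^{(r)} = Σ_{k=1}^{n} 𝔽_k^{(r-1)}  (n, r ≥ 1)
mutual
  hyperFib : ℕ → ℕ → ℚ
  hyperFib r zero = 0ℚ
  hyperFib zero (suc m) = recipFib m
  hyperFib (suc r) (suc m) = sumFrom1 r (suc m)

  sumFrom1 : ℕ → ℕ → ℚ
  sumFrom1 r zero = 0ℚ
  sumFrom1 r (suc n) = sumFrom1 r n + hyperFib r (suc n)

sumBelow : ℕ → (ℕ → ℚ) → ℚ
sumBelow zero f = 0ℚ
sumBelow (suc n) f = sumBelow n f + f n

{-# OPTIONS --safe #-}
-- Since 𝔽₀⁽ʳ⁾ = 0, the number 𝔽ₙ₋₁⁽ʳ⁺¹⁾ = 𝔽₁⁽ʳ⁾ + ⋯ + 𝔽ₙ₋₁⁽ʳ⁾ is the sum of the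
-- n non-negative numbers 𝔽ₖ⁽ʳ⁾, k < n. For non-negative a₀, …, aₙ₋₁ the sum of
-- squares is at most the square of the sum (the cross terms are non-negative),
-- and by Cauchy–Schwarz the square of the sum is at most n times the sum of squares.
module Submission where

open import Defs
open import Data.Nat as ℕ using (ℕ; _∸_; NonZero; zero; suc)
open import Data.Integer using (+_)
open import Data.Rational using (ℚ; _*_; _/_; _≤_; _+_; _-_; -_; 0ℚ; 1ℚ; 1/_; nonNegative)
open import Data.Rational.Literals using (fromℤ)
open import Data.Rational.Properties
open import Data.Rational.Solver using (module +-*-Solver)
import Data.Rational.Unnormalised.Properties as ℚᵘ
open import Data.Rational.Unnormalised using (*≡*)
import Data.Integer as ℤ using (_*_; _+_)
import Data.Integer.Properties as ℤ
open import Data.Product using (_×_; _,_)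
open import Data.Sum using (inj₁; inj₂)
open import Relation.Binary.PropositionalEquality

open +-*-Solver

≤-+-nonNegʳ : ∀ p {q} → 0ℚ ≤ q → p ≤ p + q
≤-+-nonNegʳ p 0≤q = subst (_≤ p + _) (+-identityʳ p) (+-monoʳ-≤ p 0≤q)

*-nonNeg : ∀ {p q} → 0ℚ ≤ p → 0ℚ ≤ q → 0ℚ ≤ p * q
*-nonNeg {p} {q} 0≤p 0≤q =
  nonNegative⁻¹ (p * q) {{nonNeg*nonNeg⇒nonNeg p {{nonNegative 0≤p}} q {{nonNegative 0≤q}}}}

square-nonNeg : ∀ p → 0ℚ ≤ p * p
square-nonNeg p with ≤-total 0ℚ p
... | inj₁ 0≤p = *-nonNeg 0≤p 0≤p
... | inj₂ p≤0 = subst (0ℚ ≤_) (solve 1 (λ a → (:- a) :* (:- a) := a :* a) refl p)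
                       (*-nonNeg 0≤-p 0≤-p)
  where
  0≤-p : 0ℚ ≤ - p
  0≤-p = neg-antimono-≤ p≤0

double-product≤sum-of-squares : ∀ a b → a * b + a * b ≤ a * a + b * b
double-product≤sum-of-squares a b =
  subst (a * b + a * b ≤_) (solve 2 (λ a b → a :* b :+ a :* b :+ (a :- b) :* (a :- b) := a :* a :+ b :* b) refl a b)
        (≤-+-nonNegʳ _ (square-nonNeg (a - b)))

fromℤ-suc : ∀ k → fromℤ (+ suc k) ≡ fromℤ (+ k) + 1ℚ
fromℤ-suc k = toℚᵘ-injective (ℚᵘ.≃-trans
  (*≡* (cong (ℤ._* + 1) (trans (ℤ.+-comm (+ 1) (+ k)) (cong (ℤ._+ + 1) (sym (ℤ.*-identityʳ (+ k)))))))
  (ℚᵘ.≃-sym (toℚᵘ-homo-+ (fromℤ (+ k)) 1ℚ)))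

1/n*n≡1 : ∀ n → (+ 1 / suc n) * fromℤ (+ suc n) ≡ 1ℚ
1/n*n≡1 n = trans (cong (_* fromℤ (+ suc n)) (↥p/↧p≡p (1/ fromℤ (+ suc n))))
                  (*-inverseˡ (fromℤ (+ suc n)))

sumBelow-nonNeg : ∀ f → (∀ k → 0ℚ ≤ f k) → ∀ n → 0ℚ ≤ sumBelow n f
sumBelow-nonNeg f f≥0 zero    = ≤-refl
sumBelow-nonNeg f f≥0 (suc n) = +-mono-≤ (sumBelow-nonNeg f f≥0 n) (f≥0 n)

module _ (f : ℕ → ℚ) where

  private
    Σf Σf² : ℕ → ℚ
    Σf  n = sumBelow n f
    Σf² n = sumBelow n (λ k → f k * f k)

  sumBelow-squares≤square-sumBelow : (∀ k → 0ℚ ≤ f k) → ∀ n → Σf² n ≤ Σf n * Σf n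
  sumBelow-squares≤square-sumBelow f≥0 zero    = ≤-refl
  sumBelow-squares≤square-sumBelow f≥0 (suc n) = begin
    Σf² n + y * y                       ≤⟨ +-monoˡ-≤ (y * y) (sumBelow-squares≤square-sumBelow f≥0 n) ⟩
    t * t + y * y                       ≤⟨ ≤-+-nonNegʳ _ (+-mono-≤ ty≥0 ty≥0) ⟩
    t * t + y * y + (t * y + t * y)     ≡⟨ solve 2 (λ t y → t :* t :+ y :* y :+ (t :* y :+ t :* y) := (t :+ y) :* (t :+ y)) refl t y ⟩
    (t + y) * (t + y)                   ∎
    where
    open ≤-Reasoning
    t = Σf n
    y = f n
    ty≥0 : 0ℚ ≤ t * y
    ty≥0 = *-nonNeg (sumBelow-nonNeg f f≥0 n) (f≥0 n)

  -- Summing  2 f(k) x ≤ f(k)² + x²  over k < n.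
  double-sumBelow*≤sumBelow-squares+n*square : ∀ x n →
    Σf n * x + Σf n * x ≤ Σf² n + fromℤ (+ n) * (x * x)
  double-sumBelow*≤sumBelow-squares+n*square x zero =
    ≤-reflexive (solve 1 (λ x → con 0ℚ :* x :+ con 0ℚ :* x := con 0ℚ :+ con 0ℚ :* (x :* x)) refl x)
  double-sumBelow*≤sumBelow-squares+n*square x (suc n) = begin
    (t + y) * x + (t + y) * x                   ≡⟨ solve 3 (λ t x y → (t :+ y) :* x :+ (t :+ y) :* x := t :* x :+ t :* x :+ (y :* x :+ y :* x)) refl t x y ⟩
    t * x + t * x + (y * x + y * x)             ≤⟨ +-mono-≤ (double-sumBelow*≤sumBelow-squares+n*square x n) (double-product≤sum-of-squares y x) ⟩
    s + N * (x * x) + (y * y + x * x)           ≡⟨ solve 4 (λ s N x y → s :+ N :* (x :* x) :+ (y :* y :+ x :* x) := (s :+ y :* y) :+ (N :+ con 1ℚ) :* (x :* x)) refl s N x y ⟩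
    (s + y * y) + (N + 1ℚ) * (x * x)            ≡⟨ cong (λ M → (s + y * y) + M * (x * x)) (fromℤ-suc n) ⟨
    (s + y * y) + fromℤ (+ suc n) * (x * x)     ∎
    where
    open ≤-Reasoning
    t = Σf n
    s = Σf² n
    y = f n
    N = fromℤ (+ n)

  square-sumBelow≤n*sumBelow-squares : ∀ n → Σf n * Σf n ≤ fromℤ (+ n) * Σf² n
  square-sumBelow≤n*sumBelow-squares zero    = ≤-refl
  square-sumBelow≤n*sumBelow-squares (suc n) = begin
    (t + y) * (t + y)                       ≡⟨ solve 2 (λ t y → (t :+ y) :* (t :+ y) := t :* t :+ (t :* y :+ t :* y) :+ y :* y) refl t y ⟩
    t * t + (t * y + t * y) + y * y         ≤⟨ +-monoˡ-≤ (y * y) (+-mono-≤ (square-sumBelow≤n*sumBelow-squares n) (double-sumBelow*≤sumBelow-squares+n*square y n)) ⟩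
    N * s + (s + N * (y * y)) + y * y       ≡⟨ solve 3 (λ s N y → N :* s :+ (s :+ N :* (y :* y)) :+ y :* y := (N :+ con 1ℚ) :* (s :+ y :* y)) refl s N y ⟩
    (N + 1ℚ) * (s + y * y)                  ≡⟨ cong (_* (s + y * y)) (fromℤ-suc n) ⟨
    fromℤ (+ suc n) * (s + y * y)           ∎
    where
    open ≤-Reasoning
    t = Σf n
    s = Σf² n
    y = f n
    N = fromℤ (+ n)

  square-sumBelow/n≤sumBelow-squares : ∀ n .{{_ : NonZero n}} → (+ 1 / n) * (Σf n * Σf n) ≤ Σf² n
  square-sumBelow/n≤sumBelow-squares (suc n) = begin
    c * (Σf (suc n) * Σf (suc n))           ≤⟨ *-monoˡ-≤-nonNeg c {{normalize-nonNeg 1 (suc n)}} (square-sumBelow≤n*sumBelow-squares (suc n)) ⟩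
    c * (fromℤ (+ suc n) * Σf² (suc n))     ≡⟨ *-assoc c _ _ ⟨
    c * fromℤ (+ suc n) * Σf² (suc n)       ≡⟨ cong (_* Σf² (suc n)) (1/n*n≡1 n) ⟩
    1ℚ * Σf² (suc n)                        ≡⟨ *-identityˡ _ ⟩
    Σf² (suc n)                             ∎
    where
    open ≤-Reasoning
    c = + 1 / suc n

mutual
  hyperFib-nonNeg : ∀ r k → 0ℚ ≤ hyperFib r k
  hyperFib-nonNeg r       zero    = ≤-refl
  hyperFib-nonNeg zero    (suc m) = nonNegative⁻¹ _ {{normalize-nonNeg 1 (fib (suc m)) {{ℕ.>-nonZero (fib-pos m)}}}}
  hyperFib-nonNeg (suc r) (suc m) = sumFrom1-nonNeg r (suc m)

  sumFrom1-nonNeg : ∀ r n → 0ℚ ≤ sumFrom1 r n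
  sumFrom1-nonNeg r zero    = ≤-refl
  sumFrom1-nonNeg r (suc n) = +-mono-≤ (sumFrom1-nonNeg r n) (hyperFib-nonNeg r (suc n))

sumFrom1≡sumBelow-suc : ∀ r n → sumFrom1 r n ≡ sumBelow (suc n) (hyperFib r)
sumFrom1≡sumBelow-suc r zero    = refl
sumFrom1≡sumBelow-suc r (suc n) = cong (_+ hyperFib r (suc n)) (sumFrom1≡sumBelow-suc r n)

hyperFib-suc≡sumBelow : ∀ r n → hyperFib (suc r) n ≡ sumBelow (suc n) (hyperFib r)
hyperFib-suc≡sumBelow r zero    = refl
hyperFib-suc≡sumBelow r (suc n) = sumFrom1≡sumBelow-suc r (suc n)

mainTheorem17 : (n : ℕ) → .{{_ : NonZero n}} → (r : ℕ) →
    ((+ 1 / n) * (hyperFib (ℕ.suc r) (n ∸ 1) * hyperFib (ℕ.suc r) (n ∸ 1))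
    ≤ sumBelow n (λ k → hyperFib r k * hyperFib r k))
    × (sumBelow n (λ k → hyperFib r k * hyperFib r k)
    ≤ hyperFib (ℕ.suc r) (n ∸ 1) * hyperFib (ℕ.suc r) (n ∸ 1))
mainTheorem17 (suc m) r rewrite hyperFib-suc≡sumBelow r m =
    square-sumBelow/n≤sumBelow-squares (hyperFib r) (suc m)
  , sumBelow-squares≤square-sumBelow (hyperFib r) (hyperFib-nonNeg r) (suc m)
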